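{- In the comparison model, the witness s-cover testing problem for a word $S$ of length $n$ (and a word $C$) requires $\Omega(n\log n)$ time.
   Context: A word is a finite sequence of letters. An occurrence of a word $C$ of length $m$ as a subsequence of $S$ is an increasing sequence of positions $i_0<\cdots<i_{m-1}$ of $S$ with $S[i_j]=C[j]$ for all $j$. $C$ is an s-cover of $S$ if every position of $S$ belongs to some occurrence of $C$ as a subsequence in $S$. The witness s-cover testing problem: given words $C$ and $S$, decide whether $C$ is an s-cover of $S$, and if so, output for every position $i$ of $S$ a position $j$ of $C$ such that some occurrence $i_0<\cdots<i_{m-1}$ of $C$ in $S$ has $i_j=i$ (if several such $j$ exist, any one may be output). In the comparison model, letters can be accessed only through comparisons between letters. -}

module Defs where

open import Data.Nat using (ℕ; zero; suc; _+_)
open import Data.Nat.Properties using (<-cmp)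
open import Data.Fin using (Fin)
import Data.Fin as F
open import Data.Vec using (Vec; lookup)
open import Data.Maybe using (Maybe; just; nothing)
open import Data.Sum using (_⊎_; inj₁; inj₂)
open import Data.Product using (Σ; ∃; ∃-syntax; _×_; _,_; proj₁)
open import Relation.Nullary using (¬_)
open import Relation.Binary using (Tri; tri<; tri≈; tri>)
open import Relation.Binary.PropositionalEquality using (_≡_)

-- Words: letters are natural numbers (a totally ordered alphabet);
-- algorithms below may only access letters through comparisons.
Word : ℕ → Set
Word n = Vec ℕ n

Occurrence : {m n : ℕ} → Word m → Word n → Set
Occurrence {m} {n} C S =
  Σ (Fin m → Fin n) λ o →
    ((j k : Fin m) → j F.< k → o j F.< o k) ×
    ((j : Fin m) → lookup S (o j) ≡ lookup C j)

IsSCover : {m n : ℕ} → Word m → Word n → Set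
IsSCover {m} {n} C S =
  (i : Fin n) → Σ (Occurrence C S) λ occ → ∃[ j ] proj₁ occ j ≡ i

IsWitness : {m n : ℕ} → Word m → Word n → (Fin n → Fin m) → Set
IsWitness C S f = (i : Fin _) → Σ (Occurrence C S) λ occ → proj₁ occ (f i) ≡ i

-- Comparison model: decision trees whose internal nodes compare two
-- letters (each a position of C or of S), with three outcomes <, =, >,
-- and whose leaves give the output: nothing ("C is not an s-cover")
-- or just f (a witness assignment).
Pos : ℕ → ℕ → Set
Pos m n = Fin m ⊎ Fin n

data DecTree (m n : ℕ) : Set where
  leaf : Maybe (Fin n → Fin m) → DecTree m n
  node : Pos m n → Pos m n →
         (lt eq gt : DecTree m n) → DecTree m n

letter : {m n : ℕ} → Word m → Word n → Pos m n → ℕ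
letter C S (inj₁ j) = lookup C j
letter C S (inj₂ i) = lookup S i

branch : {A : Set} → (x y : ℕ) → A → A → A → A
branch x y a b c with <-cmp x y
... | tri< _ _ _ = a
... | tri≈ _ _ _ = b
... | tri> _ _ _ = c

output : {m n : ℕ} → DecTree m n → Word m → Word n → Maybe (Fin n → Fin m)
output (leaf r) C S = r
output (node p q l e g) C S =
  branch (letter C S p) (letter C S q)
    (output l C S) (output e C S) (output g C S)

-- Number of comparisons performed on input (C, S) (a lower bound on time).
cost : {m n : ℕ} → DecTree m n → Word m → Word n → ℕ
cost (leaf r) C S = 0
cost (node p q l e g) C S =
  suc (branch (letter C S p) (letter C S q)
    (cost l C S) (cost e C S) (cost g C S))

SolvesWitnessSCover : {m n : ℕ} → DecTree m n → Set
SolvesWitnessSCover {m} {n} T =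
  (C : Word m) (S : Word n) →
    (IsSCover C S × ∃[ f ] (output T C S ≡ just f × IsWitness C S f))
    ⊎ (¬ IsSCover C S × output T C S ≡ nothing)

{-# OPTIONS --safe #-}

-- Take C = 0 1 ⋯ (m−1) and S = C X C for an arbitrary word X of length r over the letters of C.
-- C always s-covers S: a middle position holding the letter v lies on the occurrence that takes
-- C[0..v) from the first copy of C and C(v..m) from the last one.  Since the letters of C are
-- distinct, any witness must send each middle position to its own letter, so the output of a
-- correct algorithm determines X.  A ternary decision tree of depth d has at most 3^d leaves, so
-- some input costs more than any d with 3^d < m^r.  For n ≥ 16 take m = 2^(⌊log₂ n⌋−2), so that
-- 4m ≤ n, r = n − 2m ≥ n/2 and log₂ m ≥ ⌊log₂ n⌋/2; as 3 < 4, d = ⌊(r log₂ m)/2⌋ satisfies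
-- 3^d < m^r, whence 8 · cost ≥ 4 r log₂ m ≥ n ⌊log₂ n⌋.

module Submission where

open import Defs
open import Data.Empty using (⊥-elim)
open import Data.Fin as Fin using (Fin; toℕ; _↑ˡ_; _↑ʳ_; splitAt; combine; finToFun; funToFin)
import Data.Fin.Properties as Finₚ
open import Data.List using (List; []; _∷_; length)
import Data.List as List
open import Data.List.Properties using (length-++)
open import Data.List.Membership.Propositional using (_∈_)
open import Data.List.Membership.Propositional.Properties using (∈-++⁺ˡ; ∈-++⁺ʳ)
open import Data.List.Membership.Setoid.Properties using (index-injective)
open import Data.List.Relation.Unary.Any using (here; index)
open import Data.Maybe using (Maybe; just)
open import Data.Maybe.Properties using (just-injective)
open import Data.Nat using (ℕ; zero; suc; _+_; _*_; _^_; _≤_; _<_; z≤n; s≤s; z<s; _≤?_; ⌊_/2⌋; NonZero; >-nonZero)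
open import Data.Nat.Induction using (<-wellFounded)
open import Data.Nat.Logarithm using (⌊log₂_⌋; ⌊log₂⌋-mono-≤; ⌊log₂[2^n]⌋≡n)
open import Data.Nat.Logarithm.Core using (⌊log2⌋)
open import Data.Nat.Properties
  using ( ≤-refl; ≤-trans; <⇒≤; <-≤-trans; ≤-<-trans; ≰⇒>; <-cmp; m≤m+n; m≤n*m; m≤n⇒∃[o]m+o≡n
        ; +-identityʳ; +-mono-≤; +-monoˡ-≤; +-monoʳ-≤; +-monoʳ-<
        ; *-suc; *-assoc; *-mono-≤; *-monoˡ-≤; *-monoʳ-≤; *-monoʳ-<
        ; m^n>0; ^-*-assoc; ⌊n/2⌋<n; module ≤-Reasoning )
open import Data.Nat.Tactic.RingSolver using (solve-∀)
open import Data.Product using (Σ; ∃-syntax; _×_; _,_; proj₁)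
open import Data.Sum using (inj₁; inj₂)
open import Data.Vec using (lookup; tabulate; _++_)
open import Data.Vec.Properties using (lookup-++ˡ; lookup-++ʳ; lookup∘tabulate)
open import Function using (_∘_)
open import Induction.WellFounded using (Acc; acc)
open import Relation.Binary using (tri<; tri≈; tri>)
open import Relation.Binary.PropositionalEquality
  using (_≡_; _≗_; refl; cong; cong₂; sym; trans; subst; subst₂; setoid; module ≡-Reasoning)
open import Relation.Nullary using (¬_; contradiction)

outcomes : ∀ {m n} → DecTree m n → ℕ → List (Maybe (Fin n → Fin m))
outcomes (leaf r)          _       = r ∷ []
outcomes (node _ _ _ _ _)  zero    = []
outcomes (node _ _ l e g)  (suc d) = outcomes l d List.++ outcomes e d List.++ outcomes g d

length-outcomes≤3^ : ∀ {m n} (T : DecTree m n) d → length (outcomes T d) ≤ 3 ^ d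
length-outcomes≤3^ (leaf _)         d       = m^n>0 3 d
length-outcomes≤3^ (node _ _ _ _ _) zero    = z≤n
length-outcomes≤3^ (node _ _ l e g) (suc d) = begin
  length (outcomes l d List.++ outcomes e d List.++ outcomes g d)
    ≡⟨ length-++ (outcomes l d) ⟩
  length (outcomes l d) + length (outcomes e d List.++ outcomes g d)
    ≡⟨ cong (length (outcomes l d) +_) (length-++ (outcomes e d)) ⟩
  length (outcomes l d) + (length (outcomes e d) + length (outcomes g d))
    ≤⟨ +-mono-≤ (length-outcomes≤3^ l d) (+-mono-≤ (length-outcomes≤3^ e d) (length-outcomes≤3^ g d)) ⟩
  3 ^ d + (3 ^ d + 3 ^ d)
    ≡⟨ cong (λ k → 3 ^ d + (3 ^ d + k)) (sym (+-identityʳ (3 ^ d))) ⟩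
  3 ^ suc d ∎
  where open ≤-Reasoning

output∈outcomes : ∀ {m n} (T : DecTree m n) C S d → cost T C S ≤ d → output T C S ∈ outcomes T d
output∈outcomes (leaf _) C S d _ = here refl
output∈outcomes (node p q l e g) C S (suc d) (s≤s cost≤d)
  with <-cmp (letter C S p) (letter C S q)
... | tri< _ _ _ = ∈-++⁺ˡ (output∈outcomes l C S d cost≤d)
... | tri≈ _ _ _ = ∈-++⁺ʳ (outcomes l d) (∈-++⁺ˡ (output∈outcomes e C S d cost≤d))
... | tri> _ _ _ = ∈-++⁺ʳ (outcomes l d) (∈-++⁺ʳ (outcomes e d) (output∈outcomes g C S d cost≤d))

cost-lower-bound : ∀ {m n N} d (T : DecTree m n) (C : Fin N → Word m) (S : Fin N → Word n) →
  (∀ i j → output T (C i) (S i) ≡ output T (C j) (S j) → i ≡ j) →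
  3 ^ d < N → ∃[ i ] d < cost T (C i) (S i)
cost-lower-bound {N = N} d T C S output-injective 3^d<N =
  let i , cost≰d = Finₚ.¬∀⟶∃¬ N _ (λ i → cost T (C i) (S i) ≤? d) not-all-cheap
  in i , ≰⇒> cost≰d
  where
    not-all-cheap : ¬ (∀ i → cost T (C i) (S i) ≤ d)
    not-all-cheap cheap =
      let reached i = output∈outcomes T (C i) (S i) d (cheap i)
          i , j , i<j , same-leaf = Finₚ.pigeonhole (≤-<-trans (length-outcomes≤3^ T d) 3^d<N) (index ∘ reached)
          same-output = index-injective (setoid _) (reached i) (reached j) same-leaf
      in Finₚ.<-irrefl (output-injective i j same-output) i<j

↑ˡ-mono-< : ∀ {m} n {i j : Fin m} → i Fin.< j → i ↑ˡ n Fin.< j ↑ˡ n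
↑ˡ-mono-< n {i} {j} = subst₂ _<_ (sym (Finₚ.toℕ-↑ˡ i n)) (sym (Finₚ.toℕ-↑ˡ j n))

↑ʳ-mono-< : ∀ m {n} {i j : Fin n} → i Fin.< j → m ↑ʳ i Fin.< m ↑ʳ j
↑ʳ-mono-< m {i = i} {j} i<j =
  subst₂ _<_ (sym (Finₚ.toℕ-↑ʳ m i)) (sym (Finₚ.toℕ-↑ʳ m j)) (+-monoʳ-< m i<j)

↑ˡ<↑ʳ : ∀ {m n} (i : Fin m) (j : Fin n) → i ↑ˡ n Fin.< m ↑ʳ j
↑ˡ<↑ʳ {m} {n} i j =
  subst₂ _<_ (sym (Finₚ.toℕ-↑ˡ i n)) (sym (Finₚ.toℕ-↑ʳ m j)) (<-≤-trans (Finₚ.toℕ<n i) (m≤m+n m (toℕ j)))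

splice : ∀ {m n} → (Fin m → Fin n) → Fin n → (Fin m → Fin n) → Fin m → Fin m → Fin n
splice before p after v j with Finₚ.<-cmp j v
... | tri< _ _ _ = before j
... | tri≈ _ _ _ = p
... | tri> _ _ _ = after j

module _ {m : ℕ} (C : Word m) where

  occurrence-refl : Occurrence C C
  occurrence-refl = (λ j → j) , (λ _ _ j<k → j<k) , (λ _ → refl)

  occurrence-++ˡ : ∀ {n k} (S : Word n) (T : Word k) → Occurrence C S → Occurrence C (S ++ T)
  occurrence-++ˡ S T (o , o-mono , o-letter) =
    (λ j → o j ↑ˡ _) ,
    (λ j k j<k → ↑ˡ-mono-< _ (o-mono j k j<k)) ,
    (λ j → trans (lookup-++ˡ S T (o j)) (o-letter j))

  occurrence-++ʳ : ∀ {n k} (S : Word n) (T : Word k) → Occurrence C T → Occurrence C (S ++ T)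
  occurrence-++ʳ {n} S T (o , o-mono , o-letter) =
    (λ j → n ↑ʳ o j) ,
    (λ j k j<k → ↑ʳ-mono-< n (o-mono j k j<k)) ,
    (λ j → trans (lookup-++ʳ S T (o j)) (o-letter j))

  occurrence-through : ∀ {n} (S : Word n) (before after : Occurrence C S) (v : Fin m) (p : Fin n) →
    lookup S p ≡ lookup C v →
    (∀ j → j Fin.< v → proj₁ before j Fin.< p) → (∀ k → v Fin.< k → p Fin.< proj₁ after k) →
    Σ (Occurrence C S) λ occ → proj₁ occ v ≡ p
  occurrence-through S (o₁ , o₁-mono , o₁-letter) (o₂ , o₂-mono , o₂-letter) v p p-letter o₁<p p<o₂ =
    (splice o₁ p o₂ v , mono , letter-ok) , at-v
    where
      mono : ∀ j k → j Fin.< k → splice o₁ p o₂ v j Fin.< splice o₁ p o₂ v k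
      mono j k j<k with Finₚ.<-cmp j v | Finₚ.<-cmp k v
      ... | tri< _ _ _    | tri< _ _ _    = o₁-mono j k j<k
      ... | tri< j<v _ _  | tri≈ _ _ _    = o₁<p j j<v
      ... | tri< j<v _ _  | tri> _ _ v<k  = Finₚ.<-trans (o₁<p j j<v) (p<o₂ k v<k)
      ... | tri≈ _ refl _ | tri< _ _ v≮k  = ⊥-elim (v≮k j<k)
      ... | tri≈ _ refl _ | tri≈ _ refl _ = ⊥-elim (Finₚ.<-irrefl refl j<k)
      ... | tri≈ _ _ _    | tri> _ _ v<k  = p<o₂ k v<k
      ... | tri> _ _ v<j  | tri< k<v _ _  = ⊥-elim (Finₚ.<-asym (Finₚ.<-trans v<j j<k) k<v)
      ... | tri> _ _ v<j  | tri≈ _ refl _ = ⊥-elim (Finₚ.<-asym v<j j<k)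
      ... | tri> _ _ _    | tri> _ _ _    = o₂-mono j k j<k
      letter-ok : ∀ j → lookup S (splice o₁ p o₂ v j) ≡ lookup C j
      letter-ok j with Finₚ.<-cmp j v
      ... | tri< _ _ _    = o₁-letter j
      ... | tri≈ _ refl _ = p-letter
      ... | tri> _ _ _    = o₂-letter j
      at-v : splice o₁ p o₂ v v ≡ p
      at-v with Finₚ.<-cmp v v
      ... | tri< v<v _ _ = ⊥-elim (Finₚ.<-irrefl refl v<v)
      ... | tri≈ _ _ _   = refl
      ... | tri> _ _ v>v = ⊥-elim (Finₚ.<-irrefl refl v>v)

witness-letter : ∀ {m n} (C : Word m) (S : Word n) {f : Fin n → Fin m} →
  IsWitness C S f → ∀ i → lookup C (f i) ≡ lookup S i
witness-letter C S {f} w i with w i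
... | (o , _ , o-letter) , o[fi]≡i = trans (sym (o-letter (f i))) (cong (lookup S) o[fi]≡i)

funToFin-cong : ∀ {a b} {f g : Fin a → Fin b} → f ≗ g → funToFin f ≡ funToFin g
funToFin-cong {zero}  _   = refl
funToFin-cong {suc a} f≗g = cong₂ combine (f≗g Fin.zero) (funToFin-cong (f≗g ∘ Fin.suc))

finToFun-injective : ∀ {a b} {i j : Fin (b ^ a)} → finToFun {b} {a} i ≗ finToFun j → i ≡ j
finToFun-injective {a} {b} {i} {j} i≗j = begin
  i                             ≡⟨ Finₚ.funToFin-finToFin {a} {b} i ⟨
  funToFin (finToFun {b} {a} i) ≡⟨ funToFin-cong i≗j ⟩
  funToFin (finToFun {b} {a} j) ≡⟨ Finₚ.funToFin-finToFin {a} {b} j ⟩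
  j                             ∎
  where open ≡-Reasoning

witness-output : ∀ {m n} (T : DecTree m n) → SolvesWitnessSCover T → (C : Word m) (S : Word n) →
  IsSCover C S → ∃[ f ] (output T C S ≡ just f × IsWitness C S f)
witness-output T solves C S covered with solves C S
... | inj₁ (_ , found)       = found
... | inj₂ (not-covered , _) = contradiction covered not-covered

module PaddedIdentity (m r : ℕ) where

  identity : Word m
  identity = tabulate toℕ

  toWord : (Fin r → Fin m) → Word r
  toWord x = tabulate (toℕ ∘ x)

  padded : (Fin r → Fin m) → Word (m + (r + m))
  padded x = identity ++ (toWord x ++ identity)

  middle : Fin r → Fin (m + (r + m))
  middle s = m ↑ʳ (s ↑ˡ m)

  lookup-identity : ∀ j → lookup identity j ≡ toℕ j
  lookup-identity = lookup∘tabulate toℕ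

  lookup-middle : ∀ x s → lookup (padded x) (middle s) ≡ toℕ (x s)
  lookup-middle x s = begin
    lookup (padded x) (m ↑ʳ (s ↑ˡ m))       ≡⟨ lookup-++ʳ identity _ (s ↑ˡ m) ⟩
    lookup (toWord x ++ identity) (s ↑ˡ m)  ≡⟨ lookup-++ˡ (toWord x) identity s ⟩
    lookup (toWord x) s                     ≡⟨ lookup∘tabulate (toℕ ∘ x) s ⟩
    toℕ (x s)                               ∎
    where open ≡-Reasoning

  first-copy last-copy : ∀ x → Occurrence identity (padded x)
  first-copy x = occurrence-++ˡ identity identity (toWord x ++ identity) (occurrence-refl identity)
  last-copy  x = occurrence-++ʳ identity identity (toWord x ++ identity)
                   (occurrence-++ʳ identity (toWord x) identity (occurrence-refl identity))

  padded-covered : ∀ x → IsSCover identity (padded x)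
  padded-covered x i with splitAt m i in i≡
  ... | inj₁ j = first-copy x , j , Finₚ.splitAt⁻¹-↑ˡ i≡
  ... | inj₂ w with splitAt r w in w≡
  ...   | inj₂ j = last-copy x , j , trans (cong (m ↑ʳ_) (Finₚ.splitAt⁻¹-↑ʳ w≡)) (Finₚ.splitAt⁻¹-↑ʳ i≡)
  ...   | inj₁ s =
    let occ , occ[xs]≡middle = occurrence-through identity (padded x) (first-copy x) (last-copy x) (x s) (middle s)
                                 (trans (lookup-middle x s) (sym (lookup-identity (x s))))
                                 (λ j _ → ↑ˡ<↑ʳ j (s ↑ˡ m)) (λ k _ → ↑ʳ-mono-< m (↑ˡ<↑ʳ s k))
    in occ , x s , trans occ[xs]≡middle (trans (cong (m ↑ʳ_) (Finₚ.splitAt⁻¹-↑ˡ w≡)) (Finₚ.splitAt⁻¹-↑ʳ i≡))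

  witness-at-middle : ∀ x {f} → IsWitness identity (padded x) f → ∀ s → f (middle s) ≡ x s
  witness-at-middle x {f} w s = Finₚ.toℕ-injective (begin
    toℕ (f (middle s))              ≡⟨ lookup-identity (f (middle s)) ⟨
    lookup identity (f (middle s))  ≡⟨ witness-letter identity (padded x) w (middle s) ⟩
    lookup (padded x) (middle s)    ≡⟨ lookup-middle x s ⟩
    toℕ (x s)                       ∎)
    where open ≡-Reasoning

  output-determines-middle : (T : DecTree m (m + (r + m))) → SolvesWitnessSCover T → ∀ x y →
    output T identity (padded x) ≡ output T identity (padded y) → x ≗ y
  output-determines-middle T solves x y same-output s =
    let f , output≡f , f-witness = witness-output T solves identity (padded x) (padded-covered x)
        g , output≡g , g-witness = witness-output T solves identity (padded y) (padded-covered y)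
        f≡g = just-injective (trans (sym output≡f) (trans same-output output≡g))
    in begin
      x s             ≡⟨ witness-at-middle x f-witness s ⟨
      f (middle s)    ≡⟨ cong (λ h → h (middle s)) f≡g ⟩
      g (middle s)    ≡⟨ witness-at-middle y g-witness s ⟩
      y s             ∎
    where open ≡-Reasoning

  padded-lower-bound : ∀ d (T : DecTree m (m + (r + m))) → SolvesWitnessSCover T → 3 ^ d < m ^ r →
    ∃[ x ] d < cost T identity (padded x)
  padded-lower-bound d T solves 3^d<m^r =
    let k , d<cost = cost-lower-bound d T (λ _ → identity) (padded ∘ finToFun)
                       (λ i j same → finToFun-injective (output-determines-middle T solves _ _ same)) 3^d<m^r
    in finToFun k , d<cost

decision-tree-lower-bound : ∀ {m n} r d → m + (r + m) ≡ n → (T : DecTree m n) → SolvesWitnessSCover T →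
  3 ^ d < m ^ r → Σ (Word m) λ C → Σ (Word n) λ S → d < cost T C S
decision-tree-lower-bound {m} r d refl T solves 3^d<m^r =
  let x , d<cost = padded-lower-bound d T solves 3^d<m^r in identity , padded x , d<cost
  where open PaddedIdentity m r

2*⌊n/2⌋≤n : ∀ n → 2 * ⌊ n /2⌋ ≤ n
2*⌊n/2⌋≤n 0             = z≤n
2*⌊n/2⌋≤n 1             = z≤n
2*⌊n/2⌋≤n (suc (suc n)) = subst (_≤ 2 + n) (sym (*-suc 2 ⌊ n /2⌋)) (s≤s (s≤s (2*⌊n/2⌋≤n n)))

n<2*suc⌊n/2⌋ : ∀ n → n < 2 * suc ⌊ n /2⌋
n<2*suc⌊n/2⌋ 0             = s≤s z≤n
n<2*suc⌊n/2⌋ 1             = s≤s (s≤s z≤n)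
n<2*suc⌊n/2⌋ (suc (suc n)) =
  subst (2 + n <_) (sym (*-suc 2 (suc ⌊ n /2⌋))) (s≤s (s≤s (n<2*suc⌊n/2⌋ n)))

2^⌊log₂n⌋≤n : ∀ n .{{_ : NonZero n}} → 2 ^ ⌊log₂ n ⌋ ≤ n
2^⌊log₂n⌋≤n n = 2^⌊log2⌋≤ n (<-wellFounded n)
  where
    open ≤-Reasoning
    2^⌊log2⌋≤ : ∀ k .{{_ : NonZero k}} (rec : Acc _<_ k) → 2 ^ ⌊log2⌋ k rec ≤ k
    2^⌊log2⌋≤ 1             _         = ≤-refl
    2^⌊log2⌋≤ (suc (suc k)) (acc rec) = begin
      2 * 2 ^ ⌊log2⌋ (suc ⌊ k /2⌋) _ ≤⟨ *-monoʳ-≤ 2 (2^⌊log2⌋≤ (suc ⌊ k /2⌋) (rec (⌊n/2⌋<n (suc k)))) ⟩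
      2 * suc ⌊ k /2⌋               ≡⟨ *-suc 2 ⌊ k /2⌋ ⟩
      2 + 2 * ⌊ k /2⌋               ≤⟨ +-monoʳ-≤ 2 (2*⌊n/2⌋≤n k) ⟩
      2 + k                         ∎

3^⌊n/2⌋<2^n : ∀ n .{{_ : NonZero n}} → 3 ^ ⌊ n /2⌋ < 2 ^ n
3^⌊n/2⌋<2^n 1                   = s≤s (s≤s z≤n)
3^⌊n/2⌋<2^n 2                   = s≤s (s≤s (s≤s (s≤s z≤n)))
3^⌊n/2⌋<2^n (suc (suc (suc n))) = begin-strict
  3 * 3 ^ ⌊ suc n /2⌋   <⟨ *-monoʳ-< 3 (3^⌊n/2⌋<2^n (suc n)) ⟩
  3 * 2 ^ suc n         ≤⟨ *-monoˡ-≤ (2 ^ suc n) {3} {4} (s≤s (s≤s (s≤s z≤n))) ⟩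
  4 * 2 ^ suc n         ≡⟨ *-assoc 2 2 (2 ^ suc n) ⟩
  2 ^ (3 + n)           ∎
  where open ≤-Reasoning

[4m+t][2+q]≤8*suc⌊q[2m+t]/2⌋ : ∀ m q t → 2 ≤ q → (2 * (2 * m) + t) * (2 + q) ≤ 8 * suc ⌊ q * (2 * m + t) /2⌋
[4m+t][2+q]≤8*suc⌊q[2m+t]/2⌋ m q t 2≤q = begin
  (2 * (2 * m) + t) * (2 + q)             ≤⟨ *-mono-≤ (+-monoʳ-≤ (2 * (2 * m)) (m≤m+n t t)) (+-monoˡ-≤ q 2≤q) ⟩
  (2 * (2 * m) + (t + t)) * (q + q)       ≡⟨ regroup m q t ⟩
  4 * (q * (2 * m + t))                   ≤⟨ *-monoʳ-≤ 4 (<⇒≤ (n<2*suc⌊n/2⌋ (q * (2 * m + t)))) ⟩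
  4 * (2 * suc ⌊ q * (2 * m + t) /2⌋)     ≡⟨ *-assoc 4 2 (suc ⌊ q * (2 * m + t) /2⌋) ⟨
  8 * suc ⌊ q * (2 * m + t) /2⌋           ∎
  where
    open ≤-Reasoning
    regroup : ∀ m q t → (2 * (2 * m) + (t + t)) * (q + q) ≡ 4 * (q * (2 * m + t))
    regroup = solve-∀

large-n-decomposition : ∀ n → 16 ≤ n → ∃[ o ] ∃[ t ] (⌊log₂ n ⌋ ≡ 4 + o × 2 ^ (4 + o) + t ≡ n)
large-n-decomposition n 16≤n =
  let o , 4+o≡⌊log₂n⌋ = m≤n⇒∃[o]m+o≡n (subst (_≤ ⌊log₂ n ⌋) (⌊log₂[2^n]⌋≡n 4) (⌊log₂⌋-mono-≤ 16≤n))
      t , 2^⌊log₂n⌋+t≡n = m≤n⇒∃[o]m+o≡n (2^⌊log₂n⌋≤n n {{>-nonZero (<-≤-trans z<s 16≤n)}})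
  in o , t , sym 4+o≡⌊log₂n⌋ , subst (λ k → 2 ^ k + t ≡ n) (sym 4+o≡⌊log₂n⌋) 2^⌊log₂n⌋+t≡n

hard-parameters : ∀ n → 16 ≤ n →
  ∃[ m ] ∃[ r ] ∃[ d ] (m + (r + m) ≡ n × 3 ^ d < m ^ r × n * ⌊log₂ n ⌋ ≤ 8 * suc d)
hard-parameters n 16≤n with large-n-decomposition n 16≤n
... | o , t , ⌊log₂n⌋≡4+o , 2^[4+o]+t≡n = m , r , ⌊ q * r /2⌋ , m+[r+m]≡n , 3^d<m^r , nlogn≤8*suc[d]
  where
    q m r : ℕ
    q = 2 + o
    m = 2 ^ q
    r = 2 * m + t

    m+[r+m]≡n : m + (r + m) ≡ n
    m+[r+m]≡n = trans (regroup m t) 2^[4+o]+t≡n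
      where
        regroup : ∀ m t → m + ((2 * m + t) + m) ≡ 2 * (2 * m) + t
        regroup = solve-∀

    qr≢0 : NonZero (q * r)
    qr≢0 = >-nonZero (<-≤-trans (m^n>0 2 q) (≤-trans (≤-trans (m≤m+n m _) (m≤m+n (2 * m) t)) (m≤n*m r q)))

    3^d<m^r : 3 ^ ⌊ q * r /2⌋ < m ^ r
    3^d<m^r = subst (3 ^ ⌊ q * r /2⌋ <_) (sym (^-*-assoc 2 q r)) (3^⌊n/2⌋<2^n (q * r) {{qr≢0}})

    nlogn≤8*suc[d] : n * ⌊log₂ n ⌋ ≤ 8 * suc ⌊ q * r /2⌋
    nlogn≤8*suc[d] = begin
      n * ⌊log₂ n ⌋                ≡⟨ cong₂ _*_ (sym 2^[4+o]+t≡n) ⌊log₂n⌋≡4+o ⟩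
      (2 * (2 * m) + t) * (2 + q)  ≤⟨ [4m+t][2+q]≤8*suc⌊q[2m+t]/2⌋ m q t (s≤s (s≤s z≤n)) ⟩
      8 * suc ⌊ q * r /2⌋          ∎
      where open ≤-Reasoning

theorem2 : ∃[ k ] ∃[ n₀ ] ((n : ℕ) → n₀ ≤ n →
    (T : (m : ℕ) → DecTree m n) → ((m : ℕ) → SolvesWitnessSCover (T m)) →
    ∃[ m ] Σ (Word m) λ C → Σ (Word n) λ S →
      n * ⌊log₂ n ⌋ ≤ k * cost (T m) C S)
theorem2 = 8 , 16 , λ n 16≤n T solves →
  let m , r , d , m+[r+m]≡n , 3^d<m^r , nlogn≤8*suc[d] = hard-parameters n 16≤n
      C , S , d<cost = decision-tree-lower-bound r d m+[r+m]≡n (T m) (solves m) 3^d<m^r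
  in m , C , S , ≤-trans nlogn≤8*suc[d] (*-monoʳ-≤ 8 d<cost)
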